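{- Let $A$ be a unital associative $K$-algebra and $\Omega=(f(t),g(t),d(t),h(t),m(t))$ an NCS system over $A$. Then $\Omega^\tau:=(g(-t),\,f(-t),\,-d(t),\,-m(t),\,-h(t))$ is also an NCS system over $A$.
   Context: $K$ is a unital commutative $\mathbb{Q}$-algebra; $t$ is a formal central parameter and $A[[t]]$ the formal power series algebra. An NCS system over $A$ is a $5$-tuple $(f(t),g(t),d(t),h(t),m(t))\in A[[t]]^{\times5}$ with $d(0)=0$ satisfying $f(0)=1$; $f(-t)g(t)=g(t)f(-t)=1$; $e^{d(t)}=g(t)$ (with $e^{d(t)}=\sum_{k\ge0}d(t)^k/k!$); $g'(t)=g(t)h(t)$; $g'(t)=m(t)g(t)$, where $'$ denotes $d/dt$. -}

module Defs where

open import Level using (Level; _⊔_)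
open import Data.Nat using (ℕ; zero; suc; _∸_) renaming (_*_ to _*ℕ_)
open import Data.Nat.Base using (_!)
open import Data.Product using (_×_)
open import Relation.Nullary using (¬_)
open import Relation.Binary.PropositionalEquality using (_≡_)
open import Algebra.Bundles using (Ring; CommutativeRing)

module _ {a ℓ} (R : Ring a ℓ) where
  open Ring R hiding (zero)
  natR : ℕ → Carrier
  natR zero    = 0#
  natR (suc n) = 1# + natR n

-- K is a unital commutative ℚ-algebra: every nonzero natural number is
-- invertible in K (this is exactly the unique ℚ-algebra structure).
record QAlgebra {c ℓ} (K : CommutativeRing c ℓ) : Set (c ⊔ ℓ) where
  open CommutativeRing K hiding (zero)
  field
    inv      : ℕ → Carrier
    inv-spec : ∀ n → ¬ (n ≡ 0) → natR ring n * inv n ≈ 1#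

record KAlgebra {c ℓ a ℓ'} (K : CommutativeRing c ℓ) (A : Ring a ℓ')
       : Set (c ⊔ ℓ ⊔ a ⊔ ℓ') where
  module K = CommutativeRing K
  module A = Ring A
  field
    φ        : K.Carrier → A.Carrier
    φ-cong   : ∀ {x y} → x K.≈ y → φ x A.≈ φ y
    φ-+      : ∀ x y → φ (x K.+ y) A.≈ φ x A.+ φ y
    φ-*      : ∀ x y → φ (x K.* y) A.≈ φ x A.* φ y
    φ-1      : φ K.1# A.≈ A.1#
    φ-central : ∀ x b → φ x A.* b A.≈ b A.* φ x

module PowerSeries {a ℓ} (A : Ring a ℓ) where
  open Ring A hiding (zero)

  PS : Set a
  PS = ℕ → Carrier

  _≋_ : PS → PS → Set ℓ
  f ≋ g = ∀ n → f n ≈ g n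

  sumTo : ℕ → (ℕ → Carrier) → Carrier
  sumTo zero    u = 0#
  sumTo (suc n) u = sumTo n u + u n

  one : PS
  one zero    = 1#
  one (suc n) = 0#

  _⋆_ : PS → PS → PS
  (f ⋆ g) n = sumTo (suc n) (λ i → f i * g (n ∸ i))

  pow : PS → ℕ → PS
  pow f zero    = one
  pow f (suc k) = f ⋆ pow f k

  neg : PS → PS
  neg f n = - (f n)

  -- substitution t ↦ -t : f(-t)
  flip : PS → PS
  flip f zero          = f zero
  flip f (suc zero)    = - (f (suc zero))
  flip f (suc (suc n)) = flip (λ k → f (suc (suc k))) n

  deriv : PS → PS
  deriv f n = natR A (suc n) * f (suc n)

-- The exponential e^{d(t)} = Σ_k d(t)^k / k!, for d(0) = 0.  Since
-- d(t)^k has no coefficients below t^k, the t^n-coefficient of the sum is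
-- the finite sum over k ≤ n.
module Exp {c ℓ a ℓ'} {K : CommutativeRing c ℓ} (QK : QAlgebra K)
           {A : Ring a ℓ'} (alg : KAlgebra K A) where
  open Ring A hiding (zero)
  open PowerSeries A
  open QAlgebra QK using (inv)
  open KAlgebra alg using (φ)

  exp : PS → PS
  exp d n = sumTo (suc n) (λ k → φ (inv (k !)) * pow d k n)

module NCS {c ℓ a ℓ'} {K : CommutativeRing c ℓ} (QK : QAlgebra K)
           {A : Ring a ℓ'} (alg : KAlgebra K A) where
  open Ring A hiding (zero)
  open PowerSeries A public
  open Exp QK alg public

  record Tuple5 : Set a where
    constructor ⟨_,_,_,_,_⟩
    field f g d h m : PS

  IsNCS : Tuple5 → Set ℓ'
  IsNCS ⟨ f , g , d , h , m ⟩ =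
      (d 0 ≈ 0#)
    × (f 0 ≈ 1#)
    × ((flip f ⋆ g) ≋ one)
    × ((g ⋆ flip f) ≋ one)
    × (exp d ≋ g)
    × (deriv g ≋ (g ⋆ h))
    × (deriv g ≋ (m ⋆ g))

  τ : Tuple5 → Tuple5
  τ ⟨ f , g , d , h , m ⟩ = ⟨ flip g , flip f , neg d , neg m , neg h ⟩

-- Writing F = f(-t), the relations F g = g F = 1 make F the two-sided inverse of g:
-- comparing constant terms gives g(0) = 1, flipping twice gives the inverse relations
-- between g(-t) and f(-t), and differentiating g F = 1 gives F' = -F g' F, which turns
-- g' = g h and g' = m g into F' = -h F and F' = F (-m).  For e^{-d} = F: since d(0) = 0,
-- composition γ ↦ γ(d) with a scalar series γ ∈ K[[t]] is multiplicative (powers of d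
-- commute and K acts centrally), so e^{-d} e^{d} is e^{-t} e^{t} = 1 composed with d;
-- thus e^{-d} is a left inverse of g = e^{d} and equals F.
module Submission where

open import Defs
open import Algebra.Bundles using (Ring; CommutativeRing; CommutativeMonoid)
open import Data.Product using (_,_)
open import Data.Nat as ℕ using (ℕ; zero; suc; _∸_; _≤_; _<_; z≤n; s≤s; _!)
import Data.Nat.Properties as ℕ
open import Data.Sum using (inj₁; inj₂)
open import Relation.Binary.PropositionalEquality as ≡ using (_≡_)
open import Relation.Binary.Bundles using (Setoid)
import Relation.Binary.Reasoning.Setoid as SetoidReasoning

module FiniteSums {a ℓ} (R : Ring a ℓ) where
  open Ring R hiding (zero)
  open import Algebra.Properties.Ring R using (-0#≈0#; -‿+-comm)
  open import Algebra.Properties.CommutativeSemigroup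
    (CommutativeMonoid.commutativeSemigroup +-commutativeMonoid) using (interchange)
  open PowerSeries R using (sumTo)
  open SetoidReasoning setoid

  sumTo-cong : ∀ n {u v : ℕ → Carrier} → (∀ i → i < n → u i ≈ v i) → sumTo n u ≈ sumTo n v
  sumTo-cong zero    u≈v = refl
  sumTo-cong (suc n) u≈v =
    +-cong (sumTo-cong n (λ i i<n → u≈v i (ℕ.m<n⇒m<1+n i<n))) (u≈v n ℕ.≤-refl)

  sumTo-cong′ : ∀ n {u v : ℕ → Carrier} → (∀ i → u i ≈ v i) → sumTo n u ≈ sumTo n v
  sumTo-cong′ n u≈v = sumTo-cong n (λ i _ → u≈v i)

  sumTo-zero : ∀ n {u : ℕ → Carrier} → (∀ i → i < n → u i ≈ 0#) → sumTo n u ≈ 0#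
  sumTo-zero zero    u≈0 = refl
  sumTo-zero (suc n) u≈0 =
    trans (+-cong (sumTo-zero n (λ i i<n → u≈0 i (ℕ.m<n⇒m<1+n i<n))) (u≈0 n ℕ.≤-refl)) (+-identityʳ 0#)

  sumTo-+ : ∀ n (u v : ℕ → Carrier) → sumTo n (λ i → u i + v i) ≈ sumTo n u + sumTo n v
  sumTo-+ zero    u v = sym (+-identityʳ 0#)
  sumTo-+ (suc n) u v = trans (+-congʳ (sumTo-+ n u v)) (interchange _ _ _ _)

  *-distribˡ-sumTo : ∀ n x (u : ℕ → Carrier) → x * sumTo n u ≈ sumTo n (λ i → x * u i)
  *-distribˡ-sumTo zero    x u = zeroʳ x
  *-distribˡ-sumTo (suc n) x u = trans (distribˡ x _ _) (+-congʳ (*-distribˡ-sumTo n x u))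

  *-distribʳ-sumTo : ∀ n x (u : ℕ → Carrier) → sumTo n u * x ≈ sumTo n (λ i → u i * x)
  *-distribʳ-sumTo zero    x u = zeroˡ x
  *-distribʳ-sumTo (suc n) x u = trans (distribʳ x _ _) (+-congʳ (*-distribʳ-sumTo n x u))

  -‿distrib-sumTo : ∀ n (u : ℕ → Carrier) → - sumTo n u ≈ sumTo n (λ i → - u i)
  -‿distrib-sumTo zero    u = -0#≈0#
  -‿distrib-sumTo (suc n) u = trans (sym (-‿+-comm _ _)) (+-congʳ (-‿distrib-sumTo n u))

  sumTo-head : ∀ n (u : ℕ → Carrier) → sumTo (suc n) u ≈ u 0 + sumTo n (λ i → u (suc i))
  sumTo-head zero    u = +-comm 0# (u 0)
  sumTo-head (suc n) u = trans (+-congʳ (sumTo-head n u)) (+-assoc _ _ _)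

  sumTo-swap : ∀ n m (F : ℕ → ℕ → Carrier) →
    sumTo n (λ i → sumTo m (F i)) ≈ sumTo m (λ j → sumTo n (λ i → F i j))
  sumTo-swap zero    m F = sym (sumTo-zero m (λ _ _ → refl))
  sumTo-swap (suc n) m F = trans (+-congʳ (sumTo-swap n m F)) (sym (sumTo-+ m _ _))

  sumTo-extend : ∀ m N (u : ℕ → Carrier) → m ≤ N → (∀ k → m ≤ k → u k ≈ 0#) →
    sumTo N u ≈ sumTo m u
  sumTo-extend m zero    u z≤n u≈0 = refl
  sumTo-extend m (suc N) u m≤1+N u≈0 with ℕ.m≤n⇒m<n∨m≡n m≤1+N
  ... | inj₁ m<1+N =
    trans (+-cong (sumTo-extend m N u (ℕ.≤-pred m<1+N) u≈0) (u≈0 N (ℕ.≤-pred m<1+N))) (+-identityʳ _)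
  ... | inj₂ ≡.refl = refl

  sumTo-triangle : ∀ n (F : ℕ → ℕ → Carrier) →
    sumTo (suc n) (λ i → sumTo (suc i) (F i)) ≈
    sumTo (suc n) (λ j → sumTo (suc (n ∸ j)) (λ k → F (j ℕ.+ k) j))
  sumTo-triangle zero    F = refl
  sumTo-triangle (suc n) F = begin
    sumTo (suc n) (λ i → sumTo (suc i) (F i)) + sumTo (suc (suc n)) (F (suc n))
      ≈⟨ +-congʳ (sumTo-triangle n F) ⟩
    sumTo (suc n) (λ j → sumTo (suc (n ∸ j)) (λ k → F (j ℕ.+ k) j)) + sumTo (suc (suc n)) (F (suc n))
      ≈⟨ sym (+-assoc _ _ _) ⟩
    (sumTo (suc n) (λ j → sumTo (suc (n ∸ j)) (λ k → F (j ℕ.+ k) j)) + sumTo (suc n) (F (suc n)))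
      + F (suc n) (suc n)
      ≈⟨ +-cong (sym (sumTo-+ (suc n) _ _)) (sym (diagonal-end n)) ⟩
    sumTo (suc n) (λ j → sumTo (suc (n ∸ j)) (λ k → F (j ℕ.+ k) j) + F (suc n) j)
      + sumTo (suc (n ∸ n)) (λ k → F (suc n ℕ.+ k) (suc n))
      ≈⟨ +-congʳ (sumTo-cong (suc n) (λ j j<1+n → sym (row-end j (ℕ.≤-pred j<1+n)))) ⟩
    sumTo (suc n) (λ j → sumTo (suc (suc n ∸ j)) (λ k → F (j ℕ.+ k) j))
      + sumTo (suc (suc n ∸ suc n)) (λ k → F (suc n ℕ.+ k) (suc n)) ∎
    where
    row-end : ∀ j → j ≤ n → sumTo (suc (suc n ∸ j)) (λ k → F (j ℕ.+ k) j) ≈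
                            sumTo (suc (n ∸ j)) (λ k → F (j ℕ.+ k) j) + F (suc n) j
    row-end j j≤n rewrite ℕ.+-∸-assoc 1 j≤n =
      +-congˡ (reflexive (≡.cong (λ i → F i j) (≡.trans (ℕ.+-suc j (n ∸ j)) (≡.cong suc (ℕ.m+[n∸m]≡n j≤n)))))
    diagonal-end : ∀ n → sumTo (suc (n ∸ n)) (λ k → F (suc n ℕ.+ k) (suc n)) ≈ F (suc n) (suc n)
    diagonal-end n rewrite ℕ.n∸n≡0 n | ℕ.+-identityʳ n = +-identityˡ _

module Series {a ℓ} (R : Ring a ℓ) where
  open Ring R hiding (zero)
  open import Algebra.Properties.Ring R
    using (-‿distribˡ-*; -‿distribʳ-*; -‿involutive; +-inverseʳ-unique)
  open PowerSeries R
  open FiniteSums R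
  private module ≈-Reasoning = SetoidReasoning setoid

  ≋-setoid : Setoid a ℓ
  ≋-setoid = record
    { Carrier       = PS
    ; _≈_           = _≋_
    ; isEquivalence = record
      { refl  = λ _ → refl
      ; sym   = λ f≋g n → sym (f≋g n)
      ; trans = λ f≋g g≋h n → trans (f≋g n) (g≋h n)
      }
    }

  module ≋-Reasoning = SetoidReasoning ≋-setoid
  open Setoid ≋-setoid using () renaming (sym to ≋-sym)

  neg-cong : ∀ {f g : PS} → f ≋ g → neg f ≋ neg g
  neg-cong f≋g n = -‿cong (f≋g n)

  ⋆-cong-≤ : ∀ n {f f′ g g′ : PS} → (∀ i → i ≤ n → f i ≈ f′ i) → (∀ i → i ≤ n → g i ≈ g′ i) →
    (f ⋆ g) n ≈ (f′ ⋆ g′) n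
  ⋆-cong-≤ n f≈f′ g≈g′ =
    sumTo-cong (suc n) (λ i i<1+n → *-cong (f≈f′ i (ℕ.≤-pred i<1+n)) (g≈g′ (n ∸ i) (ℕ.m∸n≤m n i)))

  ⋆-cong : ∀ {f f′ g g′ : PS} → f ≋ f′ → g ≋ g′ → (f ⋆ g) ≋ (f′ ⋆ g′)
  ⋆-cong f≋f′ g≋g′ n = ⋆-cong-≤ n (λ i _ → f≋f′ i) (λ i _ → g≋g′ i)

  ⋆-congˡ : ∀ (f : PS) {g g′ : PS} → g ≋ g′ → (f ⋆ g) ≋ (f ⋆ g′)
  ⋆-congˡ f = ⋆-cong {f} {f} (λ _ → refl)

  ⋆-congʳ : ∀ (g : PS) {f f′ : PS} → f ≋ f′ → (f ⋆ g) ≋ (f′ ⋆ g)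
  ⋆-congʳ g f≋f′ = ⋆-cong {g = g} {g} f≋f′ (λ _ → refl)

  ⋆-assoc : ∀ (f g h : PS) → ((f ⋆ g) ⋆ h) ≋ (f ⋆ (g ⋆ h))
  ⋆-assoc f g h n = begin
    sumTo (suc n) (λ i → sumTo (suc i) (λ j → f j * g (i ∸ j)) * h (n ∸ i))
      ≈⟨ sumTo-cong′ (suc n) (λ i → *-distribʳ-sumTo (suc i) (h (n ∸ i)) _) ⟩
    sumTo (suc n) (λ i → sumTo (suc i) (λ j → (f j * g (i ∸ j)) * h (n ∸ i)))
      ≈⟨ sumTo-triangle n (λ i j → (f j * g (i ∸ j)) * h (n ∸ i)) ⟩
    sumTo (suc n) (λ j → sumTo (suc (n ∸ j)) (λ k → (f j * g ((j ℕ.+ k) ∸ j)) * h (n ∸ (j ℕ.+ k))))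
      ≈⟨ sumTo-cong′ (suc n) (λ j → sumTo-cong′ (suc (n ∸ j)) (reassociate j)) ⟩
    sumTo (suc n) (λ j → sumTo (suc (n ∸ j)) (λ k → f j * (g k * h ((n ∸ j) ∸ k))))
      ≈⟨ sumTo-cong′ (suc n) (λ j → sym (*-distribˡ-sumTo (suc (n ∸ j)) (f j) _)) ⟩
    sumTo (suc n) (λ j → f j * sumTo (suc (n ∸ j)) (λ k → g k * h ((n ∸ j) ∸ k))) ∎
    where
    open ≈-Reasoning
    reassociate : ∀ j k →
      (f j * g ((j ℕ.+ k) ∸ j)) * h (n ∸ (j ℕ.+ k)) ≈ f j * (g k * h ((n ∸ j) ∸ k))
    reassociate j k = trans (*-assoc _ _ _) (reflexive
      (≡.cong₂ (λ x y → f j * (g x * h y)) (ℕ.m+n∸m≡n j k) (≡.sym (ℕ.∸-+-assoc n j k))))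

  ⋆-identityˡ : ∀ (f : PS) → (one ⋆ f) ≋ f
  ⋆-identityˡ f n = trans (sumTo-head n _)
    (trans (+-cong (*-identityˡ _) (sumTo-zero n (λ i _ → zeroˡ _))) (+-identityʳ _))

  ⋆-identityʳ : ∀ (f : PS) → (f ⋆ one) ≋ f
  ⋆-identityʳ f n = trans
    (+-cong (sumTo-zero n (λ i i<n → trans (*-congˡ (reflexive (one-below i i<n))) (zeroʳ _)))
            (trans (*-congˡ (reflexive (one-diagonal n))) (*-identityʳ _)))
    (+-identityˡ _)
    where
    one-below : ∀ {n} i → i < n → one (n ∸ i) ≡ 0#
    one-below {suc n} zero    _         = ≡.refl
    one-below {suc n} (suc i) (s≤s i<n) = one-below i i<n
    one-diagonal : ∀ n → one (n ∸ n) ≡ 1#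
    one-diagonal zero    = ≡.refl
    one-diagonal (suc n) = one-diagonal n

  neg-distribˡ-⋆ : ∀ (f g : PS) → neg (f ⋆ g) ≋ (neg f ⋆ g)
  neg-distribˡ-⋆ f g n =
    trans (-‿distrib-sumTo (suc n) _) (sumTo-cong′ (suc n) (λ i → -‿distribˡ-* _ _))

  neg-distribʳ-⋆ : ∀ (f g : PS) → neg (f ⋆ g) ≋ (f ⋆ neg g)
  neg-distribʳ-⋆ f g n =
    trans (-‿distrib-sumTo (suc n) _) (sumTo-cong′ (suc n) (λ i → -‿distribʳ-* _ _))

  ⋆-inverse-unique : ∀ {e f g : PS} → (e ⋆ g) ≋ one → (g ⋆ f) ≋ one → e ≋ f
  ⋆-inverse-unique {e} {f} {g} eg≋1 gf≋1 = begin
    e             ≈⟨ ≋-sym (⋆-identityʳ e) ⟩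
    e ⋆ one       ≈⟨ ⋆-congˡ e (≋-sym gf≋1) ⟩
    e ⋆ (g ⋆ f)   ≈⟨ ≋-sym (⋆-assoc e g f) ⟩
    (e ⋆ g) ⋆ f   ≈⟨ ⋆-congʳ f eg≋1 ⟩
    one ⋆ f       ≈⟨ ⋆-identityˡ f ⟩
    f             ∎
    where open ≋-Reasoning

  sumSeries : ℕ → (ℕ → PS) → PS
  sumSeries N F m = sumTo N (λ j → F j m)

  ⋆-distrib-sumSeries : ∀ N M (F G : ℕ → PS) n →
    (sumSeries N F ⋆ sumSeries M G) n ≈ sumTo N (λ j → sumTo M (λ k → (F j ⋆ G k) n))
  ⋆-distrib-sumSeries N M F G n = begin
    sumTo (suc n) (λ i → sumTo N (λ j → F j i) * sumTo M (λ k → G k (n ∸ i)))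
      ≈⟨ sumTo-cong′ (suc n) (λ i → trans (*-distribʳ-sumTo N _ _)
           (sumTo-cong′ N (λ j → *-distribˡ-sumTo M _ _))) ⟩
    sumTo (suc n) (λ i → sumTo N (λ j → sumTo M (λ k → F j i * G k (n ∸ i))))
      ≈⟨ sumTo-swap (suc n) N _ ⟩
    sumTo N (λ j → sumTo (suc n) (λ i → sumTo M (λ k → F j i * G k (n ∸ i))))
      ≈⟨ sumTo-cong′ N (λ j → sumTo-swap (suc n) M _) ⟩
    sumTo N (λ j → sumTo M (λ k → (F j ⋆ G k) n)) ∎
    where open ≈-Reasoning

  natR-+ : ∀ m n → natR R (m ℕ.+ n) ≈ natR R m + natR R n
  natR-+ zero    n = sym (+-identityˡ _)
  natR-+ (suc m) n = trans (+-congˡ (natR-+ m n)) (sym (+-assoc _ _ _))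

  natR-* : ∀ m n → natR R (m ℕ.* n) ≈ natR R m * natR R n
  natR-* zero    n = sym (zeroˡ _)
  natR-* (suc m) n = trans (natR-+ n (m ℕ.* n))
    (trans (+-cong (sym (*-identityˡ _)) (natR-* m n)) (sym (distribʳ _ _ _)))

  natR-central : ∀ n x → natR R n * x ≈ x * natR R n
  natR-central zero    x = trans (zeroˡ x) (sym (zeroʳ x))
  natR-central (suc n) x = trans (distribʳ x _ _) (trans
    (+-cong (trans (*-identityˡ x) (sym (*-identityʳ x))) (natR-central n x))
    (sym (distribˡ x _ _)))

  deriv-⋆ : ∀ (f g : PS) n → deriv (f ⋆ g) n ≈ (deriv f ⋆ g) n + (f ⋆ deriv g) n
  deriv-⋆ f g n = begin
    natR R N * sumTo (suc N) (λ i → f i * g (N ∸ i))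
      ≈⟨ *-distribˡ-sumTo (suc N) _ _ ⟩
    sumTo (suc N) (λ i → natR R N * (f i * g (N ∸ i)))
      ≈⟨ sumTo-cong (suc N) (λ i i<1+N → split i (ℕ.≤-pred i<1+N)) ⟩
    sumTo (suc N) (λ i → left i + right i)
      ≈⟨ sumTo-+ (suc N) left right ⟩
    sumTo (suc N) left + sumTo (suc N) right
      ≈⟨ +-cong left-sum right-sum ⟩
    (deriv f ⋆ g) n + (f ⋆ deriv g) n ∎
    where
    open ≈-Reasoning
    N = suc n
    left right : ℕ → Carrier
    left  i = (natR R i * f i) * g (N ∸ i)
    right i = f i * (natR R (N ∸ i) * g (N ∸ i))
    split : ∀ i → i ≤ N → natR R N * (f i * g (N ∸ i)) ≈ left i + right i
    split i i≤N = begin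
      natR R N * (f i * g (N ∸ i))
        ≈⟨ *-congʳ (reflexive (≡.cong (natR R) (≡.sym (ℕ.m+[n∸m]≡n i≤N)))) ⟩
      natR R (i ℕ.+ (N ∸ i)) * (f i * g (N ∸ i))
        ≈⟨ trans (*-congʳ (natR-+ i (N ∸ i))) (distribʳ _ _ _) ⟩
      natR R i * (f i * g (N ∸ i)) + natR R (N ∸ i) * (f i * g (N ∸ i))
        ≈⟨ +-cong (sym (*-assoc _ _ _)) (trans (sym (*-assoc _ _ _))
             (trans (*-congʳ (natR-central (N ∸ i) (f i))) (*-assoc _ _ _))) ⟩
      left i + right i ∎
    left-sum : sumTo (suc N) left ≈ (deriv f ⋆ g) n
    left-sum = trans (sumTo-head N left)
      (trans (+-congʳ (trans (*-congʳ (zeroˡ _)) (zeroˡ _))) (+-identityˡ _))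
    right-sum : sumTo (suc N) right ≈ (f ⋆ deriv g) n
    right-sum = trans
      (+-cong (sumTo-cong N (λ i i<N → reflexive
                (≡.cong (λ k → f i * (natR R k * g k)) (ℕ.+-∸-assoc 1 (ℕ.≤-pred i<N)))))
              (trans (*-congˡ (trans (*-congʳ (reflexive (≡.cong (natR R) (ℕ.n∸n≡0 N)))) (zeroˡ _)))
                     (zeroʳ _)))
      (+-identityʳ _)

  ⋆≋one⇒⋆-deriv : ∀ {f g : PS} → (f ⋆ g) ≋ one → (f ⋆ deriv g) ≋ neg (deriv f ⋆ g)
  ⋆≋one⇒⋆-deriv {f} {g} fg≋1 n = +-inverseʳ-unique _ _
    (trans (sym (deriv-⋆ f g n)) (trans (*-congˡ (fg≋1 (suc n))) (zeroʳ _)))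

  deriv-inverse : ∀ {F g : PS} → (F ⋆ g) ≋ one → (g ⋆ F) ≋ one →
    deriv F ≋ neg (F ⋆ (deriv g ⋆ F))
  deriv-inverse {F} {g} Fg≋1 gF≋1 = begin
    deriv F                 ≈⟨ ≋-sym (⋆-identityˡ (deriv F)) ⟩
    one ⋆ deriv F           ≈⟨ ⋆-congʳ (deriv F) (≋-sym Fg≋1) ⟩
    (F ⋆ g) ⋆ deriv F       ≈⟨ ⋆-assoc F g (deriv F) ⟩
    F ⋆ (g ⋆ deriv F)       ≈⟨ ⋆-congˡ F (⋆≋one⇒⋆-deriv {g} {F} gF≋1) ⟩
    F ⋆ neg (deriv g ⋆ F)   ≈⟨ ≋-sym (neg-distribʳ-⋆ F (deriv g ⋆ F)) ⟩
    neg (F ⋆ (deriv g ⋆ F)) ∎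
    where open ≋-Reasoning

  deriv-inverseˡ : ∀ {F g m : PS} → (F ⋆ g) ≋ one → (g ⋆ F) ≋ one →
    deriv g ≋ (m ⋆ g) → deriv F ≋ (F ⋆ neg m)
  deriv-inverseˡ {F} {g} {m} Fg≋1 gF≋1 g′≋mg = begin
    deriv F                       ≈⟨ deriv-inverse Fg≋1 gF≋1 ⟩
    neg (F ⋆ (deriv g ⋆ F))       ≈⟨ neg-cong (⋆-congˡ F (⋆-congʳ F g′≋mg)) ⟩
    neg (F ⋆ ((m ⋆ g) ⋆ F))       ≈⟨ neg-cong (⋆-congˡ F (⋆-assoc m g F)) ⟩
    neg (F ⋆ (m ⋆ (g ⋆ F)))       ≈⟨ neg-cong (⋆-congˡ F (⋆-congˡ m gF≋1)) ⟩
    neg (F ⋆ (m ⋆ one))           ≈⟨ neg-cong (⋆-congˡ F (⋆-identityʳ m)) ⟩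
    neg (F ⋆ m)                   ≈⟨ neg-distribʳ-⋆ F m ⟩
    F ⋆ neg m                     ∎
    where open ≋-Reasoning

  deriv-inverseʳ : ∀ {F g h : PS} → (F ⋆ g) ≋ one → (g ⋆ F) ≋ one →
    deriv g ≋ (g ⋆ h) → deriv F ≋ (neg h ⋆ F)
  deriv-inverseʳ {F} {g} {h} Fg≋1 gF≋1 g′≋gh = begin
    deriv F                       ≈⟨ deriv-inverse Fg≋1 gF≋1 ⟩
    neg (F ⋆ (deriv g ⋆ F))       ≈⟨ neg-cong (≋-sym (⋆-assoc F (deriv g) F)) ⟩
    neg ((F ⋆ deriv g) ⋆ F)       ≈⟨ neg-cong (⋆-congʳ F (⋆-congˡ F g′≋gh)) ⟩
    neg ((F ⋆ (g ⋆ h)) ⋆ F)       ≈⟨ neg-cong (⋆-congʳ F (≋-sym (⋆-assoc F g h))) ⟩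
    neg (((F ⋆ g) ⋆ h) ⋆ F)       ≈⟨ neg-cong (⋆-congʳ F (⋆-congʳ h Fg≋1)) ⟩
    neg ((one ⋆ h) ⋆ F)           ≈⟨ neg-cong (⋆-congʳ F (⋆-identityˡ h)) ⟩
    neg (h ⋆ F)                   ≈⟨ neg-distribˡ-⋆ h F ⟩
    neg h ⋆ F                     ∎
    where open ≋-Reasoning

  signed : ℕ → Carrier → Carrier
  signed zero          x = x
  signed (suc zero)    x = - x
  signed (suc (suc n)) x = signed n x

  signed-suc : ∀ n x → signed (suc n) x ≈ - signed n x
  signed-suc zero          x = refl
  signed-suc (suc zero)    x = sym (-‿involutive x)
  signed-suc (suc (suc n)) x = signed-suc n x

  signed-involutive : ∀ n x → signed n (signed n x) ≈ x
  signed-involutive zero          x = refl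
  signed-involutive (suc zero)    x = -‿involutive x
  signed-involutive (suc (suc n)) x = signed-involutive n x

  signed-*ˡ : ∀ n x y → signed n x * y ≈ signed n (x * y)
  signed-*ˡ zero          x y = refl
  signed-*ˡ (suc zero)    x y = sym (-‿distribˡ-* x y)
  signed-*ˡ (suc (suc n)) x y = signed-*ˡ n x y

  signed-*ʳ : ∀ n x y → x * signed n y ≈ signed n (x * y)
  signed-*ʳ zero          x y = refl
  signed-*ʳ (suc zero)    x y = sym (-‿distribʳ-* x y)
  signed-*ʳ (suc (suc n)) x y = signed-*ʳ n x y

  signed-sumTo : ∀ k m (u : ℕ → Carrier) → signed k (sumTo m u) ≈ sumTo m (λ i → signed k (u i))
  signed-sumTo zero          m u = refl
  signed-sumTo (suc zero)    m u = -‿distrib-sumTo m u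
  signed-sumTo (suc (suc k)) m u = signed-sumTo k m u

  flip-signed : ∀ (f : PS) n → flip f n ≡ signed n (f n)
  flip-signed f zero          = ≡.refl
  flip-signed f (suc zero)    = ≡.refl
  flip-signed f (suc (suc n)) = flip-signed (λ k → f (suc (suc k))) n

  flip-involutive : ∀ (f : PS) → flip (flip f) ≋ f
  flip-involutive f n = trans
    (reflexive (≡.trans (flip-signed (flip f) n) (≡.cong (signed n) (flip-signed f n))))
    (signed-involutive n (f n))

  flip-cong : ∀ {f g : PS} → f ≋ g → flip f ≋ flip g
  flip-cong f≋g zero          = f≋g 0
  flip-cong f≋g (suc zero)    = -‿cong (f≋g 1)
  flip-cong f≋g (suc (suc n)) = flip-cong (λ k → f≋g (suc (suc k))) n

  deriv-flip : ∀ (f : PS) → deriv (flip f) ≋ neg (flip (deriv f))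
  deriv-flip f n = begin
    natR R (suc n) * flip f (suc n)             ≡⟨ ≡.cong (natR R (suc n) *_) (flip-signed f (suc n)) ⟩
    natR R (suc n) * signed (suc n) (f (suc n)) ≈⟨ signed-*ʳ (suc n) _ _ ⟩
    signed (suc n) (deriv f n)                  ≈⟨ signed-suc n _ ⟩
    - signed n (deriv f n)                      ≡⟨ ≡.cong -_ (flip-signed (deriv f) n) ⟨
    - flip (deriv f) n                          ∎
    where open ≈-Reasoning

  pow-+ : ∀ (f : PS) j k → (pow f j ⋆ pow f k) ≋ pow f (j ℕ.+ k)
  pow-+ f zero    k = ⋆-identityˡ (pow f k)
  pow-+ f (suc j) k = begin
    (f ⋆ pow f j) ⋆ pow f k   ≈⟨ ⋆-assoc f (pow f j) (pow f k) ⟩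
    f ⋆ (pow f j ⋆ pow f k)   ≈⟨ ⋆-congˡ f (pow-+ f j k) ⟩
    f ⋆ pow f (j ℕ.+ k)       ∎
    where open ≋-Reasoning

  pow-neg : ∀ (f : PS) k n → pow (neg f) k n ≈ signed k (pow f k n)
  pow-neg f zero    n = refl
  pow-neg f (suc k) n =
    trans (sumTo-cong′ (suc n) term) (sym (signed-sumTo (suc k) (suc n) _))
    where
    term : ∀ i → - f i * pow (neg f) k (n ∸ i) ≈ signed (suc k) (f i * pow f k (n ∸ i))
    term i = begin
      - f i * pow (neg f) k (n ∸ i)          ≈⟨ *-congˡ (pow-neg f k (n ∸ i)) ⟩
      - f i * signed k (pow f k (n ∸ i))     ≈⟨ sym (-‿distribˡ-* _ _) ⟩
      - (f i * signed k (pow f k (n ∸ i)))   ≈⟨ -‿cong (signed-*ʳ k _ _) ⟩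
      - signed k (f i * pow f k (n ∸ i))     ≈⟨ sym (signed-suc k _) ⟩
      signed (suc k) (f i * pow f k (n ∸ i)) ∎
      where open ≈-Reasoning

module ExponentialCoefficients {c ℓ} (K : CommutativeRing c ℓ) (QK : QAlgebra K) where
  open CommutativeRing K hiding (zero)
  open QAlgebra QK
  open PowerSeries ring
  open Series ring
  open SetoidReasoning setoid

  invFact : PS
  invFact k = inv (k !)

  deriv-vanishes⇒constant : ∀ (w : PS) → (∀ n → deriv w n ≈ 0#) → ∀ n → w (suc n) ≈ 0#
  deriv-vanishes⇒constant w w′≈0 n = begin
    w (suc n)                                     ≈⟨ sym (*-identityˡ _) ⟩
    1# * w (suc n)                                ≈⟨ *-congʳ (sym (inv-spec (suc n) (λ ()))) ⟩
    (natR ring (suc n) * inv (suc n)) * w (suc n) ≈⟨ *-congʳ (*-comm _ _) ⟩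
    (inv (suc n) * natR ring (suc n)) * w (suc n) ≈⟨ *-assoc _ _ _ ⟩
    inv (suc n) * deriv w n                       ≈⟨ *-congˡ (w′≈0 n) ⟩
    inv (suc n) * 0#                              ≈⟨ zeroʳ _ ⟩
    0#                                            ∎

  inv-1 : inv 1 ≈ 1#
  inv-1 = trans (sym (*-identityˡ _)) (trans (*-congʳ (sym (+-identityʳ 1#))) (inv-spec 1 (λ ())))

  deriv-invFact : deriv invFact ≋ invFact
  deriv-invFact n = begin
    natR ring N * inv (N ℕ.* F)
      ≈⟨ sym (*-identityʳ _) ⟩
    (natR ring N * inv (N ℕ.* F)) * 1#
      ≈⟨ *-congˡ (sym (inv-spec F (ℕ.≢-nonZero⁻¹ F {{n ℕ.!≢0}}))) ⟩
    (natR ring N * inv (N ℕ.* F)) * (natR ring F * inv F)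
      ≈⟨ sym (*-assoc _ _ _) ⟩
    ((natR ring N * inv (N ℕ.* F)) * natR ring F) * inv F
      ≈⟨ *-congʳ (trans (*-assoc _ _ _) (trans (*-congˡ (*-comm _ _)) (sym (*-assoc _ _ _)))) ⟩
    ((natR ring N * natR ring F) * inv (N ℕ.* F)) * inv F
      ≈⟨ *-congʳ (*-congʳ (sym (natR-* N F))) ⟩
    (natR ring (N ℕ.* F) * inv (N ℕ.* F)) * inv F
      ≈⟨ *-congʳ (inv-spec (N ℕ.* F) (ℕ.≢-nonZero⁻¹ (N ℕ.* F) {{suc n ℕ.!≢0}})) ⟩
    1# * inv F
      ≈⟨ *-identityˡ _ ⟩
    inv F ∎
    where
    N = suc n
    F = n !

  -- e^{-t} e^{t} has constant term 1 and derivative 0.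
  flip-invFact-⋆-invFact : (flip invFact ⋆ invFact) ≋ one
  flip-invFact-⋆-invFact zero    =
    trans (+-identityˡ _) (trans (*-cong inv-1 inv-1) (*-identityˡ 1#))
  flip-invFact-⋆-invFact (suc n) = deriv-vanishes⇒constant w w′≈0 n
    where
    w : PS
    w = flip invFact ⋆ invFact
    w′≈0 : ∀ n → deriv w n ≈ 0#
    w′≈0 n = begin
      deriv w n
        ≈⟨ deriv-⋆ (flip invFact) invFact n ⟩
      (deriv (flip invFact) ⋆ invFact) n + (flip invFact ⋆ deriv invFact) n
        ≈⟨ +-cong (⋆-congʳ invFact
                    (λ k → trans (deriv-flip invFact k) (-‿cong (flip-cong deriv-invFact k))) n)
                  (⋆-congˡ (flip invFact) deriv-invFact n) ⟩
      (neg (flip invFact) ⋆ invFact) n + w n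
        ≈⟨ +-congʳ (sym (neg-distribˡ-⋆ (flip invFact) invFact n)) ⟩
      - w n + w n
        ≈⟨ -‿inverseˡ _ ⟩
      0# ∎

module Substitution {c ℓ a ℓ′} {K : CommutativeRing c ℓ} (QK : QAlgebra K)
                    {A : Ring a ℓ′} (alg : KAlgebra K A) where
  open Ring A hiding (zero)
  open import Algebra.Properties.Ring A using (x+x≈x⇒x≈0; +-inverseˡ-unique)
  open PowerSeries A
  open FiniteSums A
  open Series A
  open KAlgebra alg using (φ; φ-cong; φ-+; φ-*; φ-1; φ-central)
  open Exp QK alg using (exp)
  private
    module ≈-Reasoning = SetoidReasoning setoid
    module K  = CommutativeRing K
    module KS = PowerSeries K.ring
    module KΣ = Series K.ring

  φ-0 : φ K.0# ≈ 0#
  φ-0 = x+x≈x⇒x≈0 _ (trans (sym (φ-+ K.0# K.0#)) (φ-cong (K.+-identityʳ K.0#)))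

  φ-neg : ∀ x → φ (K.- x) ≈ - φ x
  φ-neg x = +-inverseˡ-unique _ _ (trans (sym (φ-+ _ _)) (trans (φ-cong (K.-‿inverseˡ x)) φ-0))

  φ-signed : ∀ k x → φ (KΣ.signed k x) ≈ signed k (φ x)
  φ-signed zero          x = refl
  φ-signed (suc zero)    x = φ-neg x
  φ-signed (suc (suc k)) x = φ-signed k x

  φ-sumTo : ∀ m (u : ℕ → K.Carrier) → φ (KS.sumTo m u) ≈ sumTo m (λ i → φ (u i))
  φ-sumTo zero    u = φ-0
  φ-sumTo (suc m) u = trans (φ-+ _ _) (+-congʳ (φ-sumTo m u))

  φ-interchange : ∀ x y u v → (φ x * u) * (φ y * v) ≈ (φ x * φ y) * (u * v)
  φ-interchange x y u v = begin
    (φ x * u) * (φ y * v) ≈⟨ *-assoc _ _ _ ⟩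
    φ x * (u * (φ y * v)) ≈⟨ *-congˡ (sym (*-assoc _ _ _)) ⟩
    φ x * ((u * φ y) * v) ≈⟨ *-congˡ (*-congʳ (sym (φ-central y u))) ⟩
    φ x * ((φ y * u) * v) ≈⟨ *-congˡ (*-assoc _ _ _) ⟩
    φ x * (φ y * (u * v)) ≈⟨ sym (*-assoc _ _ _) ⟩
    (φ x * φ y) * (u * v) ∎
    where open ≈-Reasoning

  φ-scaled-⋆ : ∀ x y (f g : PS) n →
    ((λ m → φ x * f m) ⋆ (λ m → φ y * g m)) n ≈ (φ x * φ y) * (f ⋆ g) n
  φ-scaled-⋆ x y f g n = trans (sumTo-cong′ (suc n) (λ i → φ-interchange x y _ _))
                               (sym (*-distribˡ-sumTo (suc n) _ _))

  -- γ ⟨ d ⟩ is γ(d(t)); exp d is definitionally invFact ⟨ d ⟩.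
  _⟨_⟩ : KS.PS → PS → PS
  (γ ⟨ d ⟩) n = sumTo (suc n) (λ k → φ (γ k) * pow d k n)

  ⟨⟩-cong : ∀ {γ δ : KS.PS} (d : PS) → γ KS.≋ δ → (γ ⟨ d ⟩) ≋ (δ ⟨ d ⟩)
  ⟨⟩-cong d γ≋δ n = sumTo-cong′ (suc n) (λ k → *-congʳ (φ-cong (γ≋δ k)))

  one-⟨⟩ : ∀ (d : PS) → (KS.one ⟨ d ⟩) ≋ one
  one-⟨⟩ d n = trans (sumTo-head n _) (trans
    (+-cong (trans (*-congʳ φ-1) (*-identityˡ _)) (sumTo-zero n (λ _ _ → trans (*-congʳ φ-0) (zeroˡ _))))
    (+-identityʳ _))

  ⟨⟩-neg : ∀ (γ : KS.PS) (d : PS) → (γ ⟨ neg d ⟩) ≋ (KS.flip γ ⟨ d ⟩)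
  ⟨⟩-neg γ d n = sumTo-cong′ (suc n) term
    where
    term : ∀ k → φ (γ k) * pow (neg d) k n ≈ φ (KS.flip γ k) * pow d k n
    term k = begin
      φ (γ k) * pow (neg d) k n         ≈⟨ *-congˡ (pow-neg d k n) ⟩
      φ (γ k) * signed k (pow d k n)    ≈⟨ signed-*ʳ k _ _ ⟩
      signed k (φ (γ k) * pow d k n)    ≈⟨ sym (signed-*ˡ k _ _) ⟩
      signed k (φ (γ k)) * pow d k n    ≈⟨ *-congʳ (sym (φ-signed k (γ k))) ⟩
      φ (KΣ.signed k (γ k)) * pow d k n ≡⟨ ≡.cong (λ x → φ x * pow d k n) (KΣ.flip-signed γ k) ⟨
      φ (KS.flip γ k) * pow d k n       ∎
      where open ≈-Reasoning

  module _ {d : PS} (d₀≈0 : d 0 ≈ 0#) where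

    pow-vanishes : ∀ k m → m < k → pow d k m ≈ 0#
    pow-vanishes (suc k) m m<1+k = sumTo-zero (suc m) (λ i i<1+m → term i (ℕ.≤-pred i<1+m))
      where
      term : ∀ i → i ≤ m → d i * pow d k (m ∸ i) ≈ 0#
      term zero    _     = trans (*-congʳ d₀≈0) (zeroˡ _)
      term (suc i) 1+i≤m = trans (*-congˡ (pow-vanishes k (m ∸ suc i)
        (ℕ.<-≤-trans (ℕ.∸-monoʳ-< (s≤s z≤n) 1+i≤m) (ℕ.≤-pred m<1+k)))) (zeroʳ _)

    ⟨⟩-extend : ∀ (γ : KS.PS) {n N} → n ≤ N →
      (γ ⟨ d ⟩) n ≈ sumTo (suc N) (λ k → φ (γ k) * pow d k n)
    ⟨⟩-extend γ n≤N = sym (sumTo-extend _ _ _ (s≤s n≤N)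
      (λ k n<k → trans (*-congˡ (pow-vanishes k _ n<k)) (zeroʳ _)))

    ⟨⟩-⋆ : ∀ (γ δ : KS.PS) → ((γ ⟨ d ⟩) ⋆ (δ ⟨ d ⟩)) ≋ ((γ KS.⋆ δ) ⟨ d ⟩)
    ⟨⟩-⋆ γ δ n = begin
      ((γ ⟨ d ⟩) ⋆ (δ ⟨ d ⟩)) n
        ≈⟨ ⋆-cong-≤ n (λ _ i≤n → ⟨⟩-extend γ i≤n) (λ _ i≤n → ⟨⟩-extend δ i≤n) ⟩
      (sumSeries (suc n) (scaled γ) ⋆ sumSeries (suc n) (scaled δ)) n
        ≈⟨ ⋆-distrib-sumSeries (suc n) (suc n) (scaled γ) (scaled δ) n ⟩
      sumTo (suc n) (λ j → sumTo (suc n) (λ k → (scaled γ j ⋆ scaled δ k) n))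
        ≈⟨ sumTo-cong′ (suc n) (λ j → sumTo-cong′ (suc n) (λ k →
             trans (φ-scaled-⋆ (γ j) (δ k) (pow d j) (pow d k) n) (*-congˡ (pow-+ d j k n)))) ⟩
      sumTo (suc n) (λ j → sumTo (suc n) (λ k → (φ (γ j) * φ (δ k)) * pow d (j ℕ.+ k) n))
        ≈⟨ sumTo-cong (suc n) (λ j j<1+n → truncate j (ℕ.≤-pred j<1+n)) ⟩
      sumTo (suc n) (λ j → sumTo (suc (n ∸ j)) (λ k → term (j ℕ.+ k) j))
        ≈⟨ sym (sumTo-triangle n term) ⟩
      sumTo (suc n) (λ i → sumTo (suc i) (term i))
        ≈⟨ sumTo-cong′ (suc n) (λ i → trans (sym (*-distribʳ-sumTo (suc i) _ _))
             (*-congʳ (φ-convolution i))) ⟩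
      ((γ KS.⋆ δ) ⟨ d ⟩) n ∎
      where
      open ≈-Reasoning
      scaled : KS.PS → ℕ → PS
      scaled γ j m = φ (γ j) * pow d j m
      term : ℕ → ℕ → Carrier
      term i j = (φ (γ j) * φ (δ (i ∸ j))) * pow d i n
      truncate : ∀ j → j ≤ n →
        sumTo (suc n) (λ k → (φ (γ j) * φ (δ k)) * pow d (j ℕ.+ k) n) ≈
        sumTo (suc (n ∸ j)) (λ k → term (j ℕ.+ k) j)
      truncate j j≤n = trans
        (sumTo-extend (suc (n ∸ j)) (suc n) _ (s≤s (ℕ.m∸n≤m n j)) (λ k n∸j<k →
          trans (*-congˡ (pow-vanishes (j ℕ.+ k) n
            (≡.subst (_< j ℕ.+ k) (ℕ.m+[n∸m]≡n j≤n) (ℕ.+-monoʳ-< j n∸j<k)))) (zeroʳ _)))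
        (sumTo-cong′ (suc (n ∸ j)) (λ k → reflexive
          (≡.cong (λ i → (φ (γ j) * φ (δ i)) * pow d (j ℕ.+ k) n) (≡.sym (ℕ.m+n∸m≡n j k)))))
      φ-convolution : ∀ i → sumTo (suc i) (λ j → φ (γ j) * φ (δ (i ∸ j))) ≈ φ ((γ KS.⋆ δ) i)
      φ-convolution i =
        trans (sumTo-cong′ (suc i) (λ j → sym (φ-* _ _))) (sym (φ-sumTo (suc i) _))

  exp-neg-⋆-exp : ∀ {d : PS} → d 0 ≈ 0# → (exp (neg d) ⋆ exp d) ≋ one
  exp-neg-⋆-exp {d} d₀≈0 = begin
    (invFact ⟨ neg d ⟩) ⋆ (invFact ⟨ d ⟩)           ≈⟨ ⋆-congʳ (invFact ⟨ d ⟩) (⟨⟩-neg invFact d) ⟩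
    (KS.flip invFact ⟨ d ⟩) ⋆ (invFact ⟨ d ⟩)       ≈⟨ ⟨⟩-⋆ d₀≈0 (KS.flip invFact) invFact ⟩
    (KS.flip invFact KS.⋆ invFact) ⟨ d ⟩            ≈⟨ ⟨⟩-cong d flip-invFact-⋆-invFact ⟩
    KS.one ⟨ d ⟩                                    ≈⟨ one-⟨⟩ d ⟩
    one                                             ∎
    where
    open ExponentialCoefficients K QK using (invFact; flip-invFact-⋆-invFact)
    open ≋-Reasoning

lemma2p3 : ∀ {c ℓ a ℓ'} (K : CommutativeRing c ℓ) (QK : QAlgebra K)
             (A : Ring a ℓ') (alg : KAlgebra K A) (Ω : NCS.Tuple5 QK alg) →
             NCS.IsNCS QK alg Ω → NCS.IsNCS QK alg (NCS.τ QK alg Ω)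
lemma2p3 K QK A alg NCS.⟨ f , g , d , h , m ⟩ (d₀≈0 , f₀≈1 , f̄g≈1 , gf̄≈1 , e^d≈g , g′≈gh , g′≈mg) =
  -d₀≈0 , g₀≈1 , ≋-trans (⋆-congʳ (flip f) (flip-involutive g)) gf̄≈1 ,
  ≋-trans (⋆-congˡ (flip f) (flip-involutive g)) f̄g≈1 ,
  ⋆-inverse-unique e^-d⋆g≈1 gf̄≈1 ,
  deriv-inverseˡ f̄g≈1 gf̄≈1 g′≈mg , deriv-inverseʳ f̄g≈1 gf̄≈1 g′≈gh
  where
  open Ring A hiding (zero)
  open import Algebra.Properties.Ring A using (-0#≈0#)
  open NCS QK alg
  open Series A
  open Substitution QK alg using (exp-neg-⋆-exp)
  open Setoid ≋-setoid using () renaming (sym to ≋-sym; trans to ≋-trans)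

  -d₀≈0 : - d 0 ≈ 0#
  -d₀≈0 = trans (-‿cong d₀≈0) -0#≈0#

  g₀≈1 : g 0 ≈ 1#
  g₀≈1 = trans (sym (*-identityˡ _)) (trans (*-congʳ (sym f₀≈1)) (trans (sym (+-identityˡ _)) (f̄g≈1 0)))

  e^-d⋆g≈1 : (exp (neg d) ⋆ g) ≋ one
  e^-d⋆g≈1 = ≋-trans (⋆-congˡ (exp (neg d)) (≋-sym e^d≈g)) (exp-neg-⋆-exp d₀≈0)
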